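{- Let $k\ge 4$, $n\ge 1$, and let $G$ be a $C_4$-saturated spanning subgraph of $K_k^n$. If $u,v$ are vertices of degree $1$ in $G$ lying in different parts, then $N(u)\neq N(v)$. Moreover, the number of parts of $K_k^n$ that contain a vertex of degree $1$ in $G$ is at most $3$.
   Context: All graphs are finite, simple and undirected. $K_k^n$ denotes the complete $k$-partite graph with exactly $n$ vertices in each of its $k$ parts. $C_4$ is the cycle on $4$ vertices. A spanning subgraph $H$ of $K_k^n$ is $C_4$-saturated (relative to $K_k^n$) if $H$ contains no $C_4$ but $H+e$ contains a $C_4$ for every $e\in E(K_k^n)\setminus E(H)$. $N(u)$ is the neighbourhood of $u$ in $G$. -}

module Defs where

open import Data.Nat using (ℕ; _≡ᵇ_)
open import Data.Fin using (Fin)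
open import Data.Bool using (Bool; true; false)
open import Data.Product using (_×_; _,_; proj₁; Σ; ∃)
open import Data.Sum using (_⊎_)
open import Data.Empty using (⊥)
open import Data.List using (List; length; filterᵇ; cartesianProduct; allFin)
open import Data.Bool.ListAction using (any)
open import Relation.Binary.PropositionalEquality using (_≡_; _≢_)

-- Vertices of K_k^n: pairs (part, index within part).
Vertex : ℕ → ℕ → Set
Vertex k n = Fin k × Fin n

part : ∀ {k n} → Vertex k n → Fin k
part = proj₁

allVertices : ∀ k n → List (Vertex k n)
allVertices k n = cartesianProduct (allFin k) (allFin n)

Adj : ℕ → ℕ → Set
Adj k n = Vertex k n → Vertex k n → Bool

-- H is a (simple, undirected) spanning subgraph of K_k^n:
-- adjacency is symmetric and only joins vertices in different parts
-- (which also makes it loopless).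
record IsSpanningSubgraph {k n : ℕ} (A : Adj k n) : Set where
  field
    symmetric    : ∀ u v → A u v ≡ A v u
    betweenParts : ∀ u v → A u v ≡ true → part u ≢ part v

Edge : ∀ {k n} → Adj k n → Vertex k n → Vertex k n → Set
Edge A u v = A u v ≡ true

EdgePlus : ∀ {k n} → Adj k n → Vertex k n → Vertex k n → Vertex k n → Vertex k n → Set
EdgePlus A x y u v = Edge A u v ⊎ ((u ≡ x × v ≡ y) ⊎ (u ≡ y × v ≡ x))

HasC4 : ∀ {V : Set} → (V → V → Set) → Set
HasC4 {V} E = Σ V λ a → Σ V λ b → Σ V λ c → Σ V λ d →
  (a ≢ b × a ≢ c × a ≢ d × b ≢ c × b ≢ d × c ≢ d) ×
  (E a b × E b c × E c d × E d a)

record C4Saturated {k n : ℕ} (A : Adj k n) : Set where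
  field
    spanning  : IsSpanningSubgraph A
    c4free    : HasC4 (Edge A) → ⊥
    saturated : ∀ x y → part x ≢ part y → A x y ≡ false →
                HasC4 (EdgePlus A x y)

degree : ∀ {k n} → Adj k n → Vertex k n → ℕ
degree {k} {n} A u = length (filterᵇ (A u) (allVertices k n))

SameNbhd : ∀ {k n} → Adj k n → Vertex k n → Vertex k n → Set
SameNbhd A u v = ∀ w → A u w ≡ A v w

partsWithDegOne : ∀ {k n} → Adj k n → ℕ
partsWithDegOne {k} {n} A =
  length (filterᵇ (λ i → any (λ j → degree A (i , j) ≡ᵇ 1) (allFin n)) (allFin k))

-- If u has the single neighbour w, saturation forces a path u – b – c – y of
-- length 3 to every non-neighbour y of u in another part, and necessarily b = w.
-- Consequently two degree-1 vertices in different parts have different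
-- neighbours, and if they are non-adjacent (which a vertex in a third part
-- guarantees) their neighbours are adjacent.  Degree-1 vertices in four
-- different parts would therefore make their four neighbours a C4.
module Submission where

open import Defs
open import Data.Fin using (Fin)
open import Data.Nat using (ℕ; _≤_; _≡ᵇ_; z≤n; s≤s)
open import Data.Nat.Properties using (≡ᵇ⇒≡)
open import Data.Bool using (Bool; true; false; T)
open import Data.Bool.Properties using (T?; T-≡)
open import Data.Bool.ListAction using (any)
open import Data.Product using (Σ; ∃; _×_; _,_; proj₂)
open import Data.Sum using (_⊎_; inj₁; inj₂)
open import Data.Empty using (⊥; ⊥-elim)
open import Data.List using (List; []; _∷_; length; filterᵇ; allFin)
open import Data.List.Membership.Propositional using (_∈_)
open import Data.List.Membership.Propositional.Properties
  using (∈-filter⁺; ∈-filter⁻; ∈-cartesianProduct⁺; ∈-allFin)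
open import Data.List.Relation.Unary.All using (All; _∷_)
open import Data.List.Relation.Unary.All.Properties using (all-filter)
open import Data.List.Relation.Unary.Any using (here; satisfied)
open import Data.List.Relation.Unary.Any.Properties using (any⁻)
open import Data.List.Relation.Unary.AllPairs using (_∷_)
open import Data.List.Relation.Unary.Unique.Propositional using (Unique)
import Data.List.Relation.Unary.Unique.Propositional.Properties as Unique
open import Function using (_∘_)
open import Function.Bundles using (Equivalence)
open import Relation.Nullary using (¬_)
open import Relation.Binary.PropositionalEquality
  using (_≡_; _≢_; refl; sym; trans; cong; subst; ≢-sym)

open Equivalence using (to; from)

no-four⇒length≤3 : ∀ {a p} {X : Set a} {P : X → Set p} {xs : List X} →
  Unique xs → All P xs →
  (∀ {w x y z} → w ≢ x → w ≢ y → w ≢ z → x ≢ y → x ≢ z → y ≢ z →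
     P w → P x → P y → P z → ⊥) →
  length xs ≤ 3
no-four⇒length≤3 {xs = []}              _ _ _ = z≤n
no-four⇒length≤3 {xs = _ ∷ []}          _ _ _ = s≤s z≤n
no-four⇒length≤3 {xs = _ ∷ _ ∷ []}      _ _ _ = s≤s (s≤s z≤n)
no-four⇒length≤3 {xs = _ ∷ _ ∷ _ ∷ []}  _ _ _ = s≤s (s≤s (s≤s z≤n))
no-four⇒length≤3 {xs = _ ∷ _ ∷ _ ∷ _ ∷ _}
  ((w≢x ∷ w≢y ∷ w≢z ∷ _) ∷ (x≢y ∷ x≢z ∷ _) ∷ (y≢z ∷ _) ∷ _)
  (pw ∷ px ∷ py ∷ pz ∷ _) no-four =
  ⊥-elim (no-four w≢x w≢y w≢z x≢y x≢z y≢z pw px py pz)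

length-filterᵇ≡1 : ∀ {a} {X : Set a} (p : X → Bool) (xs : List X) →
  length (filterᵇ p xs) ≡ 1 →
  Σ X λ w → T (p w) × (∀ {y} → y ∈ xs → T (p y) → y ≡ w)
length-filterᵇ≡1 p xs len with filterᵇ p xs in eq
... | w ∷ [] = w , pw , only
  where
  pw : T (p w)
  pw = proj₂ (∈-filter⁻ (T? ∘ p) {xs = xs} (subst (w ∈_) (sym eq) (here refl)))
  only : ∀ {y} → y ∈ xs → T (p y) → y ≡ w
  only y∈xs py with subst (_ ∈_) eq (∈-filter⁺ (T? ∘ p) y∈xs py)
  ... | here y≡w = y≡w

IsC4 : {V : Set} → (V → V → Set) → V → V → V → V → Set
IsC4 E a b c d = (a ≢ b × a ≢ c × a ≢ d × b ≢ c × b ≢ d × c ≢ d) ×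
                 (E a b × E b c × E c d × E d a)

rotate : ∀ {V : Set} {E : V → V → Set} {a b c d} → IsC4 E a b c d → IsC4 E b c d a
rotate ((a≢b , a≢c , a≢d , b≢c , b≢d , c≢d) , (ab , bc , cd , da)) =
  (b≢c , b≢d , ≢-sym a≢b , c≢d , ≢-sym a≢c , ≢-sym a≢d) ,
  (bc , cd , da , ab)

module _ {k n : ℕ} where

  hasDegreeOne : Adj k n → Fin k → Bool
  hasDegreeOne A i = any (λ j → degree A (i , j) ≡ᵇ 1) (allFin n)

  ∈-allVertices : (v : Vertex k n) → v ∈ allVertices k n
  ∈-allVertices _ = ∈-cartesianProduct⁺ (∈-allFin _) (∈-allFin _)

  -- x ≢ c and b ≢ y make this a path whenever x ≢ y, as A is loopless.
  record Path₃ (A : Adj k n) (x y : Vertex k n) : Set where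
    constructor path
    field
      {b c} : Vertex k n
      x≢c   : x ≢ c
      b≢y   : b ≢ y
      x-b   : Edge A x b
      b-c   : Edge A b c
      c-y   : Edge A c y

  record Pendant (A : Adj k n) (u w : Vertex k n) : Set where
    field
      edge   : Edge A u w
      unique : ∀ {y} → Edge A u y → y ≡ w

  open Pendant

  degree≡1⇒pendant : ∀ {A : Adj k n} u → degree A u ≡ 1 → ∃ (Pendant A u)
  degree≡1⇒pendant {A} u deg with length-filterᵇ≡1 (A u) (allVertices k n) deg
  ... | w , uw , only = w , record
    { edge   = to T-≡ uw
    ; unique = λ uy → only (∈-allVertices _) (from T-≡ uy) }

  hasDegreeOne⇒pendant : ∀ {A : Adj k n} i → T (hasDegreeOne A i) →
    Σ (Fin n) λ j → ∃ (Pendant A (i , j))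
  hasDegreeOne⇒pendant {A} i t with satisfied (any⁻ _ (allFin n) t)
  ... | j , deg = j , degree≡1⇒pendant (i , j) (≡ᵇ⇒≡ _ 1 deg)

  pendant-cong : ∀ {A : Adj k n} {u v w} → SameNbhd A u v → Pendant A u w → Pendant A v w
  pendant-cong same pu = record
    { edge   = trans (sym (same _)) (edge pu)
    ; unique = λ vy → unique pu (trans (same _) vy) }

  module _ {A : Adj k n} (spanning : IsSpanningSubgraph A) where
    open IsSpanningSubgraph spanning

    edge-sym : ∀ {u v} → Edge A u v → Edge A v u
    edge-sym {u} {v} uv = trans (symmetric v u) uv

    edge⇒≢ : ∀ {u v} → Edge A u v → u ≢ v
    edge⇒≢ {u} uu refl = betweenParts u u uu refl

    Path₃-reverse : ∀ {x y} → Path₃ A x y → Path₃ A y x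
    Path₃-reverse (path x≢c b≢y x-b b-c c-y) =
      path (≢-sym b≢y) (≢-sym x≢c)
           (edge-sym c-y) (edge-sym b-c) (edge-sym x-b)

    module _ {x y : Vertex k n} where
      private
        E⁺ = EdgePlus A x y

        old-source : ∀ {p q} → p ≢ x → p ≢ y → E⁺ p q → Edge A p q
        old-source _   _   (inj₁ pq)               = pq
        old-source p≢x _   (inj₂ (inj₁ (p≡x , _))) = ⊥-elim (p≢x p≡x)
        old-source _   p≢y (inj₂ (inj₂ (p≡y , _))) = ⊥-elim (p≢y p≡y)

        old-target : ∀ {p q} → q ≢ x → q ≢ y → E⁺ p q → Edge A p q
        old-target _   _   (inj₁ pq)               = pq
        old-target _   q≢y (inj₂ (inj₁ (_ , q≡y))) = ⊥-elim (q≢y q≡y)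
        old-target q≢x _   (inj₂ (inj₂ (_ , q≡x))) = ⊥-elim (q≢x q≡x)

        -- The other three edges of a C4 of H + xy through the new edge xy lie in H.
        path-around : ∀ {a b c d} → IsC4 E⁺ a b c d →
          (a ≡ x × b ≡ y) ⊎ (a ≡ y × b ≡ x) → Path₃ A x y
        path-around ((a≢b , a≢c , a≢d , b≢c , b≢d , c≢d) , (_ , bc , cd , da))
                    (inj₁ (refl , refl)) =
          Path₃-reverse (path b≢d (≢-sym a≢c)
            (old-target (≢-sym a≢c) (≢-sym b≢c) bc)
            (old-source (≢-sym a≢c) (≢-sym b≢c) cd)
            (old-source (≢-sym a≢d) (≢-sym b≢d) da))
        path-around ((a≢b , a≢c , a≢d , b≢c , b≢d , c≢d) , (_ , bc , cd , da))
                    (inj₂ (refl , refl)) =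
          path b≢d (≢-sym a≢c)
            (old-target (≢-sym b≢c) (≢-sym a≢c) bc)
            (old-source (≢-sym b≢c) (≢-sym a≢c) cd)
            (old-source (≢-sym b≢d) (≢-sym a≢d) da)

      C4⁺⇒path : (HasC4 (Edge A) → ⊥) → HasC4 E⁺ → Path₃ A x y
      C4⁺⇒path c4free (a , b , c , d , cyc@(distinct , ab , bc , cd , da))
        with ab | bc | cd | da
      ... | inj₂ new | _ | _ | _ = path-around cyc new
      ... | inj₁ _ | inj₂ new | _ | _ = path-around (rotate cyc) new
      ... | inj₁ _ | inj₁ _ | inj₂ new | _ = path-around (rotate (rotate cyc)) new
      ... | inj₁ _ | inj₁ _ | inj₁ _ | inj₂ new =
        path-around (rotate (rotate (rotate cyc))) new
      ... | inj₁ ab′ | inj₁ bc′ | inj₁ cd′ | inj₁ da′ =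
        ⊥-elim (c4free (a , b , c , d , distinct , ab′ , bc′ , cd′ , da′))

  module _ {A : Adj k n} (S : C4Saturated A) where
    open C4Saturated S

    saturated⇒path : ∀ {x y} → part x ≢ part y → A x y ≡ false → Path₃ A x y
    saturated⇒path {x} {y} x∦y xy = C4⁺⇒path spanning c4free (saturated x y x∦y xy)

    pendant-neighbours-distinct : ∀ {u v wu wv} → part u ≢ part v →
      Pendant A u wu → Pendant A v wv → wu ≢ wv
    pendant-neighbours-distinct {u} {v} u∦v pu pv refl with A u v in uv
    ... | true = edge⇒≢ spanning (edge pv) (unique pu uv)
    ... | false with saturated⇒path u∦v uv
    ...   | path _ _ u-b b-c c-v with unique pu u-b | unique pv (edge-sym spanning c-v)
    ...     | refl | refl = edge⇒≢ spanning b-c refl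

    pendants-nonadjacent : ∀ {u v wu wv} x → part x ≢ part u → part x ≢ part v →
      Pendant A u wu → Pendant A v wv → A u v ≡ false
    pendants-nonadjacent {u} {v} x x∦u x∦v pu pv with A u v in uv
    ... | false = refl
    ... | true with A u x in ux
    ...   | true = ⊥-elim (x∦v (cong part (trans (unique pu ux) (sym (unique pu uv)))))
    ...   | false with saturated⇒path (≢-sym x∦u) ux
    ...     | path u≢c _ u-b b-c _ with trans (unique pu u-b) (sym (unique pu uv))
    ...       | refl =
      ⊥-elim (u≢c (trans (unique pv (edge-sym spanning uv)) (sym (unique pv b-c))))

    pendant-neighbours-adjacent : ∀ {u v wu wv} x →
      part u ≢ part v → part x ≢ part u → part x ≢ part v →
      Pendant A u wu → Pendant A v wv → Edge A wu wv
    pendant-neighbours-adjacent x u∦v x∦u x∦v pu pv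
      with saturated⇒path u∦v (pendants-nonadjacent x x∦u x∦v pu pv)
    ... | path _ _ u-b b-c c-v with unique pu u-b | unique pv (edge-sym spanning c-v)
    ...   | refl | refl = b-c

    no-pendants-in-four-parts : ∀ {u₁ u₂ u₃ u₄ w₁ w₂ w₃ w₄} →
      part u₁ ≢ part u₂ → part u₁ ≢ part u₃ → part u₁ ≢ part u₄ →
      part u₂ ≢ part u₃ → part u₂ ≢ part u₄ → part u₃ ≢ part u₄ →
      Pendant A u₁ w₁ → Pendant A u₂ w₂ → Pendant A u₃ w₃ → Pendant A u₄ w₄ → ⊥
    no-pendants-in-four-parts {u₁} {u₂} {u₃} {u₄}
      u₁∦u₂ u₁∦u₃ u₁∦u₄ u₂∦u₃ u₂∦u₄ u₃∦u₄ p₁ p₂ p₃ p₄ =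
      c4free (_ , _ , _ , _ ,
        ( pendant-neighbours-distinct u₁∦u₂ p₁ p₂ , pendant-neighbours-distinct u₁∦u₃ p₁ p₃
        , pendant-neighbours-distinct u₁∦u₄ p₁ p₄ , pendant-neighbours-distinct u₂∦u₃ p₂ p₃
        , pendant-neighbours-distinct u₂∦u₄ p₂ p₄ , pendant-neighbours-distinct u₃∦u₄ p₃ p₄ ) ,
        ( pendant-neighbours-adjacent u₃ u₁∦u₂ (≢-sym u₁∦u₃) (≢-sym u₂∦u₃) p₁ p₂
        , pendant-neighbours-adjacent u₄ u₂∦u₃ (≢-sym u₂∦u₄) (≢-sym u₃∦u₄) p₂ p₃
        , pendant-neighbours-adjacent u₁ u₃∦u₄ u₁∦u₃ u₁∦u₄ p₃ p₄
        , pendant-neighbours-adjacent u₂ (≢-sym u₁∦u₄) u₂∦u₄ (≢-sym u₁∦u₂) p₄ p₁ ))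

lemma4p8 : (k n : ℕ) → 4 ≤ k → 1 ≤ n → (A : Adj k n) → C4Saturated A →
    ((u v : Vertex k n) → degree A u ≡ 1 → degree A v ≡ 1 → part u ≢ part v →
      ¬ SameNbhd A u v)
    × (partsWithDegOne A ≤ 3)
lemma4p8 k n _ _ A S = different-neighbourhoods , at-most-three-parts
  where
  different-neighbourhoods : (u v : Vertex k n) → degree A u ≡ 1 → degree A v ≡ 1 →
    part u ≢ part v → ¬ SameNbhd A u v
  different-neighbourhoods u v deg-u _ u∦v same with degree≡1⇒pendant u deg-u
  ... | w , pu = pendant-neighbours-distinct S u∦v pu (pendant-cong same pu) refl

  at-most-three-parts : partsWithDegOne A ≤ 3
  at-most-three-parts =
    no-four⇒length≤3 (Unique.filter⁺ (T? ∘ hasDegreeOne A) (Unique.allFin⁺ k))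
                     (all-filter (T? ∘ hasDegreeOne A) (allFin k))
                     no-four-parts
    where
    no-four-parts : ∀ {i₁ i₂ i₃ i₄} →
      i₁ ≢ i₂ → i₁ ≢ i₃ → i₁ ≢ i₄ → i₂ ≢ i₃ → i₂ ≢ i₄ → i₃ ≢ i₄ →
      T (hasDegreeOne A i₁) → T (hasDegreeOne A i₂) →
      T (hasDegreeOne A i₃) → T (hasDegreeOne A i₄) → ⊥
    no-four-parts {i₁} {i₂} {i₃} {i₄} i₁≢i₂ i₁≢i₃ i₁≢i₄ i₂≢i₃ i₂≢i₄ i₃≢i₄ t₁ t₂ t₃ t₄
      with hasDegreeOne⇒pendant i₁ t₁ | hasDegreeOne⇒pendant i₂ t₂
         | hasDegreeOne⇒pendant i₃ t₃ | hasDegreeOne⇒pendant i₄ t₄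
    ... | _ , _ , p₁ | _ , _ , p₂ | _ , _ , p₃ | _ , _ , p₄ =
      no-pendants-in-four-parts S i₁≢i₂ i₁≢i₃ i₁≢i₄ i₂≢i₃ i₂≢i₄ i₃≢i₄ p₁ p₂ p₃ p₄
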